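{- Let $K_{a,b}$ be the complete bipartite graph with sides $L$ ($|L|=a$) and $R$ ($|R|=b$), let $\sigma$ be a confined position of the parallel chip-firing game on $K_{a,b}$, and let $t\ge 0$. If $a$ divides $\alpha_t(L)$, then $u_t(\sigma,v)=\alpha_t(L)/a$ for all $v\in L$.
   Context: Parallel chip-firing game: a position $\sigma$ assigns a nonnegative integer to each vertex; at each step every vertex $v$ with at least $\deg(v)$ chips simultaneously sends one chip to each neighbor. $U$ is the step operator. $\Phi_\sigma(v)$ is the number of neighbors $w$ of $v$ with $\sigma(w)\ge\deg(w)$. A position is confined if every vertex satisfies $\Phi_\sigma(v)\le\sigma(v)\le\Phi_\sigma(v)+\deg(v)-1$. $u_t(\sigma,v)=|\{s:0\le s<t,\ U^s\sigma(v)\ge\deg(v)\}|$. $\alpha_t(L)=\sum_{v\in L}u_t(\sigma,v)$, the total number of firings of vertices of $L$ in the first $t$ steps. -}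

module Defs where

open import Data.Nat using (ℕ; zero; suc; _+_; _∸_; _≤_; _<_; _≤ᵇ_)
open import Data.Bool using (Bool; true; false; if_then_else_)
open import Data.Fin using (Fin)
open import Data.Sum using (_⊎_; inj₁; inj₂)
open import Data.Product using (_×_)

Σ-Fin : (n : ℕ) → (Fin n → ℕ) → ℕ
Σ-Fin zero    f = 0
Σ-Fin (suc n) f = f Fin.zero + Σ-Fin n (λ i → f (Fin.suc i))

-- Vertices of the complete bipartite graph K_{a,b}:
-- inj₁ i (i : Fin a) are the vertices of L, inj₂ j (j : Fin b) those of R.
Vertex : ℕ → ℕ → Set
Vertex a b = Fin a ⊎ Fin b

deg : {a b : ℕ} → Vertex a b → ℕ
deg {a} {b} (inj₁ _) = b
deg {a} {b} (inj₂ _) = a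

Position : ℕ → ℕ → Set
Position a b = Vertex a b → ℕ

fires : {a b : ℕ} → Position a b → Vertex a b → Bool
fires σ v = deg v ≤ᵇ σ v

indicator : Bool → ℕ
indicator true  = 1
indicator false = 0

-- Φ_σ(v): number of neighbours w of v with σ(w) ≥ deg(w).
-- In K_{a,b} the neighbours of an L-vertex are exactly R, and vice versa.
Φ : {a b : ℕ} → Position a b → Vertex a b → ℕ
Φ {a} {b} σ (inj₁ _) = Σ-Fin b (λ j → indicator (fires σ (inj₂ j)))
Φ {a} {b} σ (inj₂ _) = Σ-Fin a (λ i → indicator (fires σ (inj₁ i)))

U : {a b : ℕ} → Position a b → Position a b
U σ v = (if fires σ v then σ v ∸ deg v else σ v) + Φ σ v

U^ : {a b : ℕ} → ℕ → Position a b → Position a b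
U^ zero    σ = σ
U^ (suc s) σ = U (U^ s σ)

-- confined: Φ_σ(v) ≤ σ(v) ≤ Φ_σ(v) + deg(v) - 1 for every v
-- (the upper bound written as a strict inequality, i.e. over the integers)
Confined : {a b : ℕ} → Position a b → Set
Confined σ = ∀ v → (Φ σ v ≤ σ v) × (σ v < Φ σ v + deg v)

u : {a b : ℕ} → ℕ → Position a b → Vertex a b → ℕ
u zero    σ v = 0
u (suc t) σ v = u t σ v + indicator (fires (U^ t σ) v)

αL : {a b : ℕ} → ℕ → Position a b → ℕ
αL {a} {b} t σ = Σ-Fin a (λ i → u t σ (inj₁ i))

module Submission where

-- For a vertex v of K_{a,b} the number of chips is governed by
-- a conservation law: chips now plus deg v times the number of firings so far
-- equals initial chips plus chips received so far.  Two vertices on the same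
-- side of K_{a,b} are "twins": they have the same degree and always the same
-- number of firing neighbours, hence receive exactly the same chips.  If twins
-- v, w start with σ w ≤ σ v < σ w + deg v, the conservation law shows that at
-- every time v has fired as often as w or exactly once more (the vertex with
-- more chips cannot fall behind, and the vertex that is ahead cannot pull
-- further ahead).  Confinement guarantees this starting condition for any two
-- twins, so the firing counts of the L-vertices differ pairwise by at most
-- one.  A family of naturals with this property whose sum is a·q is constant
-- with value q, which is the theorem.

open import Defs
open import Data.Nat using (ℕ; zero; suc; _+_; _*_; _∸_; _≤_; _<_; z≤n)
open import Data.Nat.Properties
open import Algebra.Properties.CommutativeSemigroup +-commutativeSemigroup
  using (x∙yz≈xz∙y; xy∙z≈xz∙y)
open import Data.Nat.Divisibility using (_∣_; quotient; divides)
open import Data.Fin using (Fin)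
open import Data.Sum using (_⊎_; inj₁; inj₂)
open import Data.Product using (proj₁; proj₂)
open import Data.Bool using (true; false; T)
open import Data.Unit using (tt)
open import Data.Empty using (⊥-elim)
open import Relation.Nullary.Negation using (contradiction)
open import Relation.Nullary.Reflects using (Reflects; ofʸ; ofⁿ)
open import Relation.Binary.PropositionalEquality
open import Relation.Binary.Definitions using (tri<; tri≈; tri>)

Σ-mono-≤ : ∀ n {f g : Fin n → ℕ} → (∀ i → f i ≤ g i) → Σ-Fin n f ≤ Σ-Fin n g
Σ-mono-≤ zero    f≤g = z≤n
Σ-mono-≤ (suc n) f≤g = +-mono-≤ (f≤g Fin.zero) (Σ-mono-≤ n (λ i → f≤g (Fin.suc i)))

Σ-mono-< : ∀ n {f g : Fin n → ℕ} → (∀ i → f i ≤ g i) → (i : Fin n) → f i < g i →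
           Σ-Fin n f < Σ-Fin n g
Σ-mono-< (suc n) f≤g Fin.zero    fi<gi = +-mono-<-≤ fi<gi (Σ-mono-≤ n (λ j → f≤g (Fin.suc j)))
Σ-mono-< (suc n) f≤g (Fin.suc i) fi<gi =
  +-mono-≤-< (f≤g Fin.zero) (Σ-mono-< n (λ j → f≤g (Fin.suc j)) i fi<gi)

Σ-const : ∀ n q → Σ-Fin n (λ _ → q) ≡ n * q
Σ-const zero    q = refl
Σ-const (suc n) q = cong (q +_) (Σ-const n q)

-- A family of naturals whose values pairwise differ by at most one and whose
-- sum is n·q is constantly q: one value below q (resp. above q) would force
-- all values to be ≤ q (resp. ≥ q) and the sum to be < n·q (resp. > n·q).
balanced-sum : ∀ n (f : Fin n → ℕ) q → (∀ i j → f i ≤ suc (f j)) →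
               Σ-Fin n f ≡ n * q → ∀ i → f i ≡ q
balanced-sum n f q close sum≡ i with <-cmp (f i) q
... | tri≈ _ fi≡q _ = fi≡q
... | tri< fi<q _ _ =
  ⊥-elim (<-irrefl sum≡const (Σ-mono-< n (λ j → ≤-trans (close j i) fi<q) i fi<q))
  where sum≡const = trans sum≡ (sym (Σ-const n q))
... | tri> _ _ q<fi =
  ⊥-elim (<-irrefl (sym sum≡const) (Σ-mono-< n (λ j → ≤-pred (≤-trans q<fi (close i j))) i q<fi))
  where sum≡const = trans sum≡ (sym (Σ-const n q))

module _ {a b : ℕ} where

  fires-reflects : (τ : Position a b) (v : Vertex a b) → Reflects (deg v ≤ τ v) (fires τ v)
  fires-reflects τ v = ≤ᵇ-reflects-≤ (deg v) (τ v)

  fires-sound : (τ : Position a b) (v : Vertex a b) → fires τ v ≡ true → deg v ≤ τ v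
  fires-sound τ v fv = ≤ᵇ⇒≤ (deg v) (τ v) (subst T (sym fv) tt)

  step-balance : (τ : Position a b) (v : Vertex a b) →
                 U τ v + deg v * indicator (fires τ v) ≡ τ v + Φ τ v
  step-balance τ v with fires τ v | fires-reflects τ v
  ... | true  | ofʸ deg≤τv = begin
      τ v ∸ deg v + Φ τ v + deg v * 1  ≡⟨ cong (τ v ∸ deg v + Φ τ v +_) (*-identityʳ (deg v)) ⟩
      τ v ∸ deg v + Φ τ v + deg v      ≡⟨ xy∙z≈xz∙y (τ v ∸ deg v) (Φ τ v) (deg v) ⟩
      τ v ∸ deg v + deg v + Φ τ v      ≡⟨ cong (_+ Φ τ v) (m∸n+n≡m deg≤τv) ⟩
      τ v + Φ τ v                      ∎
    where open ≡-Reasoning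
  ... | false | ofⁿ _ = trans (cong (τ v + Φ τ v +_) (*-zeroʳ (deg v))) (+-identityʳ _)

  inflow : ℕ → Position a b → Vertex a b → ℕ
  inflow zero    σ v = 0
  inflow (suc t) σ v = inflow t σ v + Φ (U^ t σ) v

  conservation : ∀ t (σ : Position a b) v → U^ t σ v + deg v * u t σ v ≡ σ v + inflow t σ v
  conservation zero    σ v = cong (σ v +_) (*-zeroʳ (deg v))
  conservation (suc t) σ v = begin
      U τ v + d * (n + k)          ≡⟨ cong (U τ v +_) (*-distribˡ-+ d n k) ⟩
      U τ v + (d * n + d * k)      ≡⟨ x∙yz≈xz∙y (U τ v) (d * n) (d * k) ⟩
      U τ v + d * k + d * n        ≡⟨ cong (_+ d * n) (step-balance τ v) ⟩
      τ v + Φ τ v + d * n          ≡⟨ xy∙z≈xz∙y (τ v) (Φ τ v) (d * n) ⟩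
      τ v + d * n + Φ τ v          ≡⟨ cong (_+ Φ τ v) (conservation t σ v) ⟩
      σ v + inflow t σ v + Φ τ v   ≡⟨ +-assoc (σ v) (inflow t σ v) (Φ τ v) ⟩
      σ v + inflow (suc t) σ v     ∎
    where
    open ≡-Reasoning
    τ = U^ t σ
    d = deg v
    n = u t σ v
    k = indicator (fires τ v)

  record Twins (v w : Vertex a b) : Set where
    field
      same-deg : deg w ≡ deg v
      same-Φ   : ∀ τ → Φ τ w ≡ Φ τ v
  open Twins

  L-twins : (i j : Fin a) → Twins (inj₁ i) (inj₁ j)
  L-twins i j = record { same-deg = refl ; same-Φ = λ _ → refl }

  twins-sym : ∀ {v w} → Twins v w → Twins w v
  twins-sym tw = record { same-deg = sym (same-deg tw) ; same-Φ = λ τ → sym (same-Φ tw τ) }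

  -- Twins receive the same chips, so conservation for w can be written with the data of v.
  twin-conservation : ∀ {v w} → Twins v w → ∀ t (σ : Position a b) →
                      U^ t σ w + deg v * u t σ w ≡ σ w + inflow t σ v
  twin-conservation {v} {w} tw t σ =
    subst₂ (λ d r → U^ t σ w + d * u t σ w ≡ σ w + r)
           (same-deg tw) (same-inflow t) (conservation t σ w)
    where
    same-inflow : ∀ t → inflow t σ w ≡ inflow t σ v
    same-inflow zero    = refl
    same-inflow (suc t) = cong₂ _+_ (same-inflow t) (same-Φ tw (U^ t σ))

  twin-fires : ∀ {v w} → Twins v w → (τ : Position a b) → τ w ≤ τ v →
               fires τ w ≡ true → fires τ v ≡ true
  twin-fires {v} {w} tw τ τw≤τv fw with fires τ v | fires-reflects τ v
  ... | true  | _         = refl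
  ... | false | ofⁿ deg≰ =
    ⊥-elim (deg≰ (≤-trans (≤-reflexive (sym (same-deg tw))) (≤-trans (fires-sound τ w fw) τw≤τv)))

  FiringGap : ℕ → ℕ → Set
  FiringGap m n = (m ≡ n) ⊎ (m ≡ suc n)

  gap-upper : ∀ {m n} → FiringGap m n → m ≤ suc n
  gap-upper (inj₁ m≡n)  = ≤-trans (≤-reflexive m≡n) (n≤1+n _)
  gap-upper (inj₂ m≡1+n) = ≤-reflexive m≡1+n

  gap-lower : ∀ {m n} → FiringGap m n → n ≤ m
  gap-lower (inj₁ m≡n)  = ≤-reflexive (sym m≡n)
  gap-lower (inj₂ m≡1+n) = ≤-trans (n≤1+n _) (≤-reflexive (sym m≡1+n))

  module _ {v w : Vertex a b} (tw : Twins v w) (σ : Position a b) where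

    -- With equal firing counts, the chip difference of twins is the initial one.
    level-order : σ w ≤ σ v → ∀ t → u t σ v ≡ u t σ w → U^ t σ w ≤ U^ t σ v
    level-order σw≤σv t same = +-cancelʳ-≤ (deg v * u t σ w) _ _ (begin
        U^ t σ w + deg v * u t σ w   ≡⟨ twin-conservation tw t σ ⟩
        σ w + inflow t σ v           ≤⟨ +-monoˡ-≤ (inflow t σ v) σw≤σv ⟩
        σ v + inflow t σ v           ≡⟨ conservation t σ v ⟨
        U^ t σ v + deg v * u t σ v   ≡⟨ cong (λ n → U^ t σ v + deg v * n) same ⟩
        U^ t σ v + deg v * u t σ w   ∎)
      where open ≤-Reasoning

    -- A vertex one firing ahead of its twin holds strictly fewer chips, since
    -- the initial difference is less than the degree.
    ahead-order : σ v < σ w + deg v → ∀ t → u t σ v ≡ suc (u t σ w) → U^ t σ v < U^ t σ w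
    ahead-order σv<σw+d t ahead = +-cancelʳ-< (deg v * suc n) _ _ (begin-strict
        U^ t σ v + deg v * suc n        ≡⟨ cong (λ m → U^ t σ v + deg v * m) ahead ⟨
        U^ t σ v + deg v * u t σ v      ≡⟨ conservation t σ v ⟩
        σ v + inflow t σ v              <⟨ +-monoˡ-< (inflow t σ v) σv<σw+d ⟩
        σ w + deg v + inflow t σ v      ≡⟨ xy∙z≈xz∙y (σ w) (deg v) (inflow t σ v) ⟩
        σ w + inflow t σ v + deg v      ≡⟨ cong (_+ deg v) (twin-conservation tw t σ) ⟨
        U^ t σ w + deg v * n + deg v    ≡⟨ +-assoc (U^ t σ w) (deg v * n) (deg v) ⟩
        U^ t σ w + (deg v * n + deg v)  ≡⟨ cong (U^ t σ w +_) (+-comm (deg v * n) (deg v)) ⟩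
        U^ t σ w + (deg v + deg v * n)  ≡⟨ cong (U^ t σ w +_) (*-suc (deg v) n) ⟨
        U^ t σ w + deg v * suc n        ∎)
      where
      open ≤-Reasoning
      n = u t σ w

    -- If σ w ≤ σ v < σ w + deg v, then at every time v has fired as often as
    -- w or exactly once more: when level, only v can fire alone; when ahead,
    -- only w can fire alone.
    firing-gap : σ w ≤ σ v → σ v < σ w + deg v → ∀ t → FiringGap (u t σ v) (u t σ w)
    firing-gap σw≤σv σv<σw+d zero = inj₁ refl
    firing-gap σw≤σv σv<σw+d (suc t) with firing-gap σw≤σv σv<σw+d t
    ... | inj₁ same with fires (U^ t σ) v in fv | fires (U^ t σ) w in fw
    ...   | true  | true  = inj₁ (cong (_+ 1) same)
    ...   | false | false = inj₁ (cong (_+ 0) same)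
    ...   | true  | false = inj₂ (trans (+-comm (u t σ v) 1) (cong suc (trans same (sym (+-identityʳ _)))))
    ...   | false | true  =
      contradiction (trans (sym fv) (twin-fires tw (U^ t σ) (level-order σw≤σv t same) fw)) λ ()
    firing-gap σw≤σv σv<σw+d (suc t) | inj₂ ahead with fires (U^ t σ) v in fv | fires (U^ t σ) w in fw
    ...   | true  | true  = inj₂ (cong (_+ 1) ahead)
    ...   | false | false = inj₂ (trans (+-identityʳ _) (trans ahead (cong suc (sym (+-identityʳ _)))))
    ...   | false | true  = inj₁ (trans (+-identityʳ _) (trans ahead (+-comm 1 (u t σ w))))
    ...   | true  | false =
      contradiction (trans (sym fw)
                      (twin-fires (twins-sym tw) (U^ t σ) (<⇒≤ (ahead-order σv<σw+d t ahead)) fv)) λ ()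

  -- In a confined position twins differ by less than their degree:
  -- σ v < Φ σ v + deg v = Φ σ w + deg v ≤ σ w + deg v.
  confined-spread : ∀ {σ : Position a b} {v w} → Confined σ → Twins v w → σ v < σ w + deg v
  confined-spread {σ} {v} {w} conf tw =
    <-≤-trans (proj₂ (conf v)) (+-monoˡ-≤ (deg v) (subst (_≤ σ w) (same-Φ tw σ) (proj₁ (conf w))))

  twins-fire-evenly : ∀ {σ : Position a b} {v w} → Confined σ → Twins v w →
                      ∀ t → u t σ v ≤ suc (u t σ w)
  twins-fire-evenly {σ} {v} {w} conf tw t with ≤-total (σ w) (σ v)
  ... | inj₁ σw≤σv = gap-upper (firing-gap tw σ σw≤σv (confined-spread conf tw) t)
  ... | inj₂ σv≤σw = ≤-trans (gap-lower (firing-gap (twins-sym tw) σ σv≤σw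
                                          (confined-spread conf (twins-sym tw)) t)) (n≤1+n _)

lemma3p2 : (a b : ℕ) (σ : Position a b) → Confined σ → (t : ℕ) →
    (d : a ∣ αL t σ) → (i : Fin a) → u t σ (inj₁ i) ≡ quotient d
lemma3p2 a b σ conf t (divides q αL≡q*a) =
  balanced-sum a (λ i → u t σ (inj₁ i)) q
    (λ i j → twins-fire-evenly conf (L-twins i j) t)
    (trans αL≡q*a (*-comm q a))
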